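{- Let $\mathbf{L}=\langle L,\leq,\otimes,\rightarrow,0,1\rangle$ be a complete residuated lattice, $Y\neq\emptyset$, and $K$ a $\leq$-filter in $\mathbf{L}$. An operator $C\colon L^Y\to L^Y$ is an $\mathbf{L}_K$-closure operator if and only if it is an $S$-closure operator for $S=\{\langle f_a,h_a\rangle;\ a\in K\}$, where $f_a(B)=a\otimes B$ and $h_a(B)=a\rightarrow B$ for $B\in L^Y$; that is, iff for all $A,B\in L^Y$ and $a\in K$: $A\subseteq C(A)$, $A\subseteq B$ implies $C(A)\subseteq C(B)$, and $C(a\rightarrow C(A))\subseteq a\rightarrow C(A)$.
   Context: Complete residuated lattice: $\langle L,\leq\rangle$ complete lattice with bounds $0,1$, $\otimes$ associative, commutative, neutral $1$, $a\otimes b\leq c$ iff $b\leq a\rightarrow c$. A $\leq$-filter is a nonempty $K\subseteq L$ with $a\in K$, $a\leq b$ implying $b\in K$. $L^Y$: maps $Y\to L$; $A\subseteq B$ iff $A(y)\leq B(y)$ for all $y$; $(a\otimes B)(y)=a\otimes B(y)$, $(a\rightarrow B)(y)=a\rightarrow B(y)$; $S(A,B)=\bigwedge_y(A(y)\rightarrow B(y))$. $\mathbf{L}_K$-closure operator: $A\subseteq C(A)$, $C(C(A))\subseteq C(A)$, and $S(A,B)\in K$ implies $S(A,B)\leq S(C(A),C(B))$, for all $A,B$. For a set $S$ of isotone Galois connections on $\langle L^Y,\subseteq\rangle$, an $S$-closure operator is $C$ extensive, monotone, with $C(h(C(A)))\subseteq h(C(A))$ for all $\langle f,h\rangle\in S$.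 -}

module Defs where

open import Level using (Level; _⊔_; suc)
open import Data.Product using (Σ; ∃; _,_)
open import Relation.Binary.PropositionalEquality using (_≡_)
open import Relation.Binary.Structures using (IsPartialOrder)

record CompleteResiduatedLattice (c i : Level) : Set (Level.suc (c ⊔ i)) where
  infixr 7 _⊗_
  infixr 5 _⇒_
  infix 4 _≤_
  field
    Carrier : Set c
    _≤_ : Carrier → Carrier → Set c
    isPartialOrder : IsPartialOrder _≡_ _≤_
    ⋀ : {I : Set i} → (I → Carrier) → Carrier
    ⋀-lower : {I : Set i} (g : I → Carrier) (j : I) → ⋀ g ≤ g j
    ⋀-greatest : {I : Set i} (g : I → Carrier) (x : Carrier) → (∀ j → x ≤ g j) → x ≤ ⋀ g
    ⋁ : {I : Set i} → (I → Carrier) → Carrier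
    ⋁-upper : {I : Set i} (g : I → Carrier) (j : I) → g j ≤ ⋁ g
    ⋁-least : {I : Set i} (g : I → Carrier) (x : Carrier) → (∀ j → g j ≤ x) → ⋁ g ≤ x
    𝟘 𝟙 : Carrier
    𝟘-least : ∀ x → 𝟘 ≤ x
    𝟙-greatest : ∀ x → x ≤ 𝟙
    _⊗_ : Carrier → Carrier → Carrier
    ⊗-assoc : ∀ x y z → (x ⊗ y) ⊗ z ≡ x ⊗ (y ⊗ z)
    ⊗-comm : ∀ x y → x ⊗ y ≡ y ⊗ x
    ⊗-identityˡ : ∀ x → 𝟙 ⊗ x ≡ x
    _⇒_ : Carrier → Carrier → Carrier
    residuation₁ : ∀ a b c → a ⊗ b ≤ c → b ≤ a ⇒ c
    residuation₂ : ∀ a b c → b ≤ a ⇒ c → a ⊗ b ≤ c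

module _ {c i : Level} (𝐋 : CompleteResiduatedLattice c i) where
  open CompleteResiduatedLattice 𝐋

  record IsFilter {k : Level} (K : Carrier → Set k) : Set (c ⊔ k) where
    field
      nonempty : ∃ K
      upward : ∀ {a b} → K a → a ≤ b → K b

  module _ (Y : Set i) where
    LSet : Set (c ⊔ i)
    LSet = Y → Carrier

    _⊆_ : LSet → LSet → Set (c ⊔ i)
    A ⊆ B = ∀ y → A y ≤ B y

    _⊗ₛ_ : Carrier → LSet → LSet
    (a ⊗ₛ B) y = a ⊗ B y

    _⇒ₛ_ : Carrier → LSet → LSet
    (a ⇒ₛ B) y = a ⇒ B y

    Sub : LSet → LSet → Carrier
    Sub A B = ⋀ (λ y → A y ⇒ B y)

    record IsLKClosure {k : Level} (K : Carrier → Set k) (C : LSet → LSet) : Set (c ⊔ i ⊔ k) where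
      field
        extensive : ∀ A → A ⊆ C A
        idempotent : ∀ A → C (C A) ⊆ C A
        compatible : ∀ A B → K (Sub A B) → Sub A B ≤ Sub (C A) (C B)

    record IsSClosure {j : Level} {J : Set j} (S : J → Σ (LSet → LSet) (λ _ → LSet → LSet))
                      (C : LSet → LSet) : Set (c ⊔ i ⊔ j) where
      field
        extensive : ∀ A → A ⊆ C A
        monotone : ∀ A B → A ⊆ B → C A ⊆ C B
        closedᵢ : ∀ (x : J) A → let h = Σ.proj₂ (S x) in C (h (C A)) ⊆ h (C A)

    S-K : {k : Level} (K : Carrier → Set k) → Σ Carrier K → Σ (LSet → LSet) (λ _ → LSet → LSet)
    S-K K (a , _) = (λ B → a ⊗ₛ B) , (λ B → a ⇒ₛ B)

-- Everything reduces to the residuation law for subsethood degrees,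
-- a ≤ S(A,B) iff A ⊆ a → B. With a = 1 (which lies in every filter) it turns
-- A ⊆ B into 1 ≤ S(A,B), so compatibility yields monotonicity, and h₁ = id
-- turns closedness under h₁ into idempotency. For general a ∈ K it translates
-- compatibility at the pair (a → C(A), C(A)) into C(a → C(A)) ⊆ a → C(A) and
-- back.
module Submission where

open import Defs
open import Level using (Level)
open import Function.Bundles using (_⇔_; mk⇔)
open import Data.Product using (_×_; _,_; proj₂)
open import Relation.Binary.PropositionalEquality using (subst)
open import Relation.Binary.Structures using (IsPartialOrder)

module ResiduatedLatticeProperties {c i : Level} (𝐋 : CompleteResiduatedLattice c i) where
  open CompleteResiduatedLattice 𝐋
  open IsPartialOrder isPartialOrder using (reflexive)
  open IsPartialOrder isPartialOrder public using () renaming (refl to ≤-refl; trans to ≤-trans)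

  ⇒-modusPonens : ∀ a x → a ⊗ (a ⇒ x) ≤ x
  ⇒-modusPonens a x = residuation₂ a (a ⇒ x) x ≤-refl

  ≤⇒-exchange : ∀ {a b x} → a ≤ b ⇒ x → b ≤ a ⇒ x
  ≤⇒-exchange {a} {b} {x} p =
    residuation₁ a b x (subst (_≤ x) (⊗-comm b a) (residuation₂ b a x p))

  ⇒-monoʳ : ∀ a {x y} → x ≤ y → a ⇒ x ≤ a ⇒ y
  ⇒-monoʳ a x≤y = residuation₁ a _ _ (≤-trans (⇒-modusPonens a _) x≤y)

  𝟙⇒-elim : ∀ x → 𝟙 ⇒ x ≤ x
  𝟙⇒-elim x = subst (_≤ x) (⊗-identityˡ (𝟙 ⇒ x)) (⇒-modusPonens 𝟙 x)

  𝟙⇒-intro : ∀ x → x ≤ 𝟙 ⇒ x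
  𝟙⇒-intro x = residuation₁ 𝟙 x x (reflexive (⊗-identityˡ x))

  filter-𝟙 : ∀ {k} {K : Carrier → Set k} → IsFilter 𝐋 K → K 𝟙
  filter-𝟙 F = upward (proj₂ nonempty) (𝟙-greatest _)
    where open IsFilter F

  module LSetProperties (Y : Set i) where

    infix 4 _⊆ₛ_
    _⊆ₛ_ : LSet 𝐋 Y → LSet 𝐋 Y → Set _
    _⊆ₛ_ = _⊆_ 𝐋 Y

    infixr 5 _⇒ₗ_
    _⇒ₗ_ : Carrier → LSet 𝐋 Y → LSet 𝐋 Y
    _⇒ₗ_ = _⇒ₛ_ 𝐋 Y

    ⊆-refl : ∀ {A} → A ⊆ₛ A
    ⊆-refl y = ≤-refl

    ⊆-trans : ∀ {A B D} → A ⊆ₛ B → B ⊆ₛ D → A ⊆ₛ D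
    ⊆-trans A⊆B B⊆D y = ≤-trans (A⊆B y) (B⊆D y)

    ⇒ₗ-monoʳ : ∀ a {A B} → A ⊆ₛ B → a ⇒ₗ A ⊆ₛ a ⇒ₗ B
    ⇒ₗ-monoʳ a A⊆B y = ⇒-monoʳ a (A⊆B y)

    𝟙⇒ₗ-elim : ∀ A → 𝟙 ⇒ₗ A ⊆ₛ A
    𝟙⇒ₗ-elim A y = 𝟙⇒-elim (A y)

    𝟙⇒ₗ-intro : ∀ A → A ⊆ₛ 𝟙 ⇒ₗ A
    𝟙⇒ₗ-intro A y = 𝟙⇒-intro (A y)

    ≤Sub⇒⊆⇒ₗ : ∀ {a A B} → a ≤ Sub 𝐋 Y A B → A ⊆ₛ a ⇒ₗ B
    ≤Sub⇒⊆⇒ₗ {A = A} {B} a≤S y = ≤⇒-exchange (≤-trans a≤S (⋀-lower (λ y → A y ⇒ B y) y))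

    ⊆⇒ₗ⇒≤Sub : ∀ {a A B} → A ⊆ₛ a ⇒ₗ B → a ≤ Sub 𝐋 Y A B
    ⊆⇒ₗ⇒≤Sub {a} A⊆a⇒B = ⋀-greatest _ a (λ y → ≤⇒-exchange (A⊆a⇒B y))

    ⊆⇒𝟙≤Sub : ∀ {A B} → A ⊆ₛ B → 𝟙 ≤ Sub 𝐋 Y A B
    ⊆⇒𝟙≤Sub {B = B} A⊆B = ⊆⇒ₗ⇒≤Sub (⊆-trans A⊆B (𝟙⇒ₗ-intro B))

    𝟙≤Sub⇒⊆ : ∀ {A B} → 𝟙 ≤ Sub 𝐋 Y A B → A ⊆ₛ B
    𝟙≤Sub⇒⊆ {B = B} 𝟙≤S = ⊆-trans (≤Sub⇒⊆⇒ₗ 𝟙≤S) (𝟙⇒ₗ-elim B)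

module ClosureProperties {c i k : Level} (𝐋 : CompleteResiduatedLattice c i) (Y : Set i)
                         {K : CompleteResiduatedLattice.Carrier 𝐋 → Set k} (F : IsFilter 𝐋 K)
                         (C : LSet 𝐋 Y → LSet 𝐋 Y) where
  open CompleteResiduatedLattice 𝐋
  open ResiduatedLatticeProperties 𝐋
  open LSetProperties Y
  open IsFilter F using (upward)

  IsLKClosure⇒IsSClosure : IsLKClosure 𝐋 Y K C → IsSClosure 𝐋 Y (S-K 𝐋 Y K) C
  IsLKClosure⇒IsSClosure lk = record
    { extensive = extensive
    ; monotone  = monotone
    ; closedᵢ   = λ { (a , Ka) A → closed a Ka A }
    }
    where
    open IsLKClosure lk

    monotone : ∀ A B → A ⊆ₛ B → C A ⊆ₛ C B
    monotone A B A⊆B = 𝟙≤Sub⇒⊆ (≤-trans 𝟙≤S (compatible A B (upward (filter-𝟙 F) 𝟙≤S)))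
      where 𝟙≤S = ⊆⇒𝟙≤Sub A⊆B

    closed : ∀ a → K a → ∀ A → C (a ⇒ₗ C A) ⊆ₛ a ⇒ₗ C A
    closed a Ka A = ⊆-trans (≤Sub⇒⊆⇒ₗ a≤S[CD,CCA]) (⇒ₗ-monoʳ a (idempotent A))
      where
      a≤S : a ≤ Sub 𝐋 Y (a ⇒ₗ C A) (C A)
      a≤S = ⊆⇒ₗ⇒≤Sub ⊆-refl
      a≤S[CD,CCA] : a ≤ Sub 𝐋 Y (C (a ⇒ₗ C A)) (C (C A))
      a≤S[CD,CCA] = ≤-trans a≤S (compatible _ _ (upward Ka a≤S))

  IsSClosure⇒IsLKClosure : IsSClosure 𝐋 Y (S-K 𝐋 Y K) C → IsLKClosure 𝐋 Y K C
  IsSClosure⇒IsLKClosure sc = record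
    { extensive  = extensive
    ; idempotent = idempotent
    ; compatible = compatible
    }
    where
    open IsSClosure sc

    closed : ∀ a → K a → ∀ A → C (a ⇒ₗ C A) ⊆ₛ a ⇒ₗ C A
    closed a Ka = closedᵢ (a , Ka)

    idempotent : ∀ A → C (C A) ⊆ₛ C A
    idempotent A = ⊆-trans (monotone _ _ (𝟙⇒ₗ-intro (C A)))
                           (⊆-trans (closed 𝟙 (filter-𝟙 F) A) (𝟙⇒ₗ-elim (C A)))

    compatible : ∀ A B → K (Sub 𝐋 Y A B) → Sub 𝐋 Y A B ≤ Sub 𝐋 Y (C A) (C B)
    compatible A B Ks = ⊆⇒ₗ⇒≤Sub (⊆-trans (monotone _ _ A⊆s⇒CB) (closed s Ks B))
      where
      s = Sub 𝐋 Y A B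
      A⊆s⇒CB : A ⊆ₛ s ⇒ₗ C B
      A⊆s⇒CB = ⊆-trans (≤Sub⇒⊆⇒ₗ ≤-refl) (⇒ₗ-monoʳ s (extensive B))

  IsSClosure⇔explicit : IsSClosure 𝐋 Y (S-K 𝐋 Y K) C ⇔
    ((∀ A → A ⊆ₛ C A)
     × (∀ A B → A ⊆ₛ B → C A ⊆ₛ C B)
     × (∀ A a → K a → C (a ⇒ₗ C A) ⊆ₛ a ⇒ₗ C A))
  IsSClosure⇔explicit = mk⇔
    (λ sc → let open IsSClosure sc in extensive , monotone , λ A a Ka → closedᵢ (a , Ka) A)
    (λ { (ext , mono , closed) → record
           { extensive = ext ; monotone = mono ; closedᵢ = λ { (a , Ka) A → closed A a Ka } } })

corollary11 : {c i k : Level} (𝐋 : CompleteResiduatedLattice c i) (Y : Set i) (y₀ : Y)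
              (K : CompleteResiduatedLattice.Carrier 𝐋 → Set k) → IsFilter 𝐋 K →
              (C : LSet 𝐋 Y → LSet 𝐋 Y) →
              (IsLKClosure 𝐋 Y K C ⇔ IsSClosure 𝐋 Y (S-K 𝐋 Y K) C)
                × (IsSClosure 𝐋 Y (S-K 𝐋 Y K) C ⇔
                    ((∀ A → _⊆_ 𝐋 Y A (C A))
                     × (∀ A B → _⊆_ 𝐋 Y A B → _⊆_ 𝐋 Y (C A) (C B))
                     × (∀ A (a : CompleteResiduatedLattice.Carrier 𝐋) → K a →
                          _⊆_ 𝐋 Y (C (_⇒ₛ_ 𝐋 Y a (C A))) (_⇒ₛ_ 𝐋 Y a (C A)))))
corollary11 𝐋 Y _ K F C =
  mk⇔ IsLKClosure⇒IsSClosure IsSClosure⇒IsLKClosure , IsSClosure⇔explicit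
  where open ClosureProperties 𝐋 Y F C
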